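{- Let $G=(V,E_G)$ be the $d$-dimensional grid graph with side lengths $(n_1,\dots,n_d)$, let $E,F\in V$ be two distinct non-adjacent vertices, and let $G'=(V,E_G\cup\{EF\})$. Then $\beta(G')\le 2d+2$. Moreover, with $N_\Sigma=\sum_i n_i$ and $N_\Pi=\prod_i n_i$, $$\beta(G')\ge \frac{\log(N_\Pi)}{\log(N_\Sigma-d+1)}.$$
   Context: The $d$-dimensional grid graph with side lengths $(n_1,\dots,n_d)$ has vertices the integer vectors $(x^{(1)},\dots,x^{(d)})$ with $1\le x^{(i)}\le n_i$, two vertices adjacent iff they differ by exactly $1$ in exactly one coordinate. For a connected graph $H$, a set $R$ of vertices is resolving if every pair of distinct vertices $A\ne B$ has some $X\in R$ with $d_H(A,X)\ne d_H(B,X)$ ($d_H$ = shortest-path distance); the metric dimension $\beta(H)$ is the minimum size of a resolving set. -}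

module Defs where

open import Data.Nat using (ℕ; zero; suc; _+_; _∸_; _≤_; ∣_-_∣)
open import Data.Fin using (Fin)
open import Data.Vec using (Vec; lookup)
open import Data.List using (List; length)
open import Data.List.Relation.Unary.All using (All)
open import Data.List.Membership.Propositional using (_∈_)
open import Data.List.Relation.Unary.Unique.Propositional using (Unique)
open import Data.Product using (_×_; ∃; ∃-syntax; Σ-syntax)
open import Data.Sum using (_⊎_)
open import Relation.Binary.PropositionalEquality using (_≡_; _≢_)

-- A point of ℕ^d; coordinates are 1-based as in the paper.
Point : ℕ → Set
Point d = Vec ℕ d

InGrid : ∀ {d} → Vec ℕ d → Point d → Set
InGrid {d} n x = (i : Fin d) → (1 ≤ lookup x i) × (lookup x i ≤ lookup n i)

GridAdj : ∀ {d} → Point d → Point d → Set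
GridAdj {d} x y = Σ[ i ∈ Fin d ]
  ((∣ lookup x i - lookup y i ∣ ≡ 1) × ((j : Fin d) → j ≢ i → lookup x j ≡ lookup y j))

AdjG' : ∀ {d} → Vec ℕ d → Point d → Point d → Point d → Point d → Set
AdjG' n E F x y = InGrid n x × InGrid n y
  × (GridAdj x y ⊎ ((x ≡ E × y ≡ F) ⊎ (x ≡ F × y ≡ E)))

data Walk {V : Set} (Adj : V → V → Set) : V → V → ℕ → Set where
  here : ∀ {x} → Walk Adj x x 0
  step : ∀ {x y z k} → Adj x y → Walk Adj y z k → Walk Adj x z (suc k)

Dist : {V : Set} → (V → V → Set) → V → V → ℕ → Set
Dist Adj x y k = Walk Adj x y k × (∀ m → Walk Adj x y m → k ≤ m)

Resolving : ∀ {d} → Vec ℕ d → Point d → Point d → List (Point d) → Set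
Resolving n E F R =
  All (InGrid n) R ×
  (∀ A B → InGrid n A → InGrid n B → A ≢ B →
     ∃[ X ] (X ∈ R × ∃[ k₁ ] ∃[ k₂ ]
        (Dist (AdjG' n E F) A X k₁ × Dist (AdjG' n E F) B X k₂ × k₁ ≢ k₂)))

IsMetricDim : ∀ {d} → Vec ℕ d → Point d → Point d → ℕ → Set
IsMetricDim n E F β =
  (∃[ R ] (Resolving n E F R × Unique R × length R ≡ β)) ×
  (∀ R → Resolving n E F R → Unique R → β ≤ length R)

open import Data.Vec using ([]; _∷_)
open import Data.Nat using (_*_)

NΣ : ∀ {d} → Vec ℕ d → ℕ
NΣ [] = 0
NΣ (x ∷ xs) = x + NΣ xs

NΠ : ∀ {d} → Vec ℕ d → ℕ
NΠ [] = 1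
NΠ (x ∷ xs) = x * NΠ xs

module Submission where

-- In G′ a shortest walk uses the new edge EF at most once, so d_G′(A, X) is the least of the ℓ¹
-- distance ∣A − X∣₁ and the lengths ∣A − E∣₁ + 1 + ∣F − X∣₁ and ∣A − F∣₁ + 1 + ∣E − X∣₁ of the two
-- detours through EF.
--
-- Upper bound: E, F, the d corners c listed in corners and their antipodes c̄ resolve G′. The
-- distances to E and F tell whether a vertex A is nearer (in ℓ¹) to E or to F; say to E. Since
-- ∣A − c∣₁ + ∣A − c̄∣₁ does not depend on A, one of c, c̄ is itself nearer to E than to F, and for
-- that landmark the G′-distance from A is the ℓ¹ distance. This recovers ∣A − c∣₁ for every
-- corner c, and these ℓ¹ distances determine A coordinate by coordinate.
--
-- Lower bound: the G′-distances to a resolving set R separate the N_Π vertices and lie in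
-- {0, …, N_Σ − d}, so N_Π ≤ (N_Σ − d + 1)^|R|.

open import Defs
open import Data.Nat using (ℕ; zero; suc; _+_; _*_; _∸_; _^_; _≤_; _<_; z≤n; s≤s; ∣_-_∣; _⊓_)
open import Data.Nat.Properties
open import Algebra.Properties.CommutativeSemigroup +-commutativeSemigroup using (interchange)
open import Data.Empty using (⊥-elim)
open import Data.Unit using (⊤; tt)
open import Data.Product using (_×_; _,_; proj₁; proj₂; ∃-syntax)
open import Data.Sum using (_⊎_; inj₁; inj₂)
open import Data.Fin using () renaming (zero to fz; suc to fs)
open import Function using (id)
open import Relation.Nullary using (¬_; yes; no)
open import Relation.Binary.Definitions using (DecidableEquality; tri<; tri≈; tri>)
open import Relation.Binary.PropositionalEquality
open import Data.List
  using (List; []; _∷_; map; length; _++_; deduplicate; cartesianProductWith; applyUpTo; upTo)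
open import Data.List.Properties
  using (length-++; length-map; length-deduplicate; length-applyUpTo; length-upTo)
open import Data.List.Membership.Propositional using (_∈_; find)
open import Data.List.Membership.Propositional.Properties
  using (∈-map⁺; ∈-map⁻; ∈-++⁺ˡ; ∈-++⁺ʳ; ∈-deduplicate⁺; ∈-∃++; ∈-applyUpTo⁻; ∈-upTo⁺)
open import Data.List.Relation.Unary.Any using (here; there)
import Data.List.Relation.Unary.Any.Properties as Any
open import Data.List.Relation.Unary.All as All using (All; []; _∷_; all?)
open import Data.List.Relation.Unary.All.Properties as All using (¬All⇒Any¬)
open import Data.List.Relation.Unary.AllPairs using ([]; _∷_)
open import Data.List.Relation.Unary.Unique.Propositional using (Unique)
import Data.List.Relation.Unary.Unique.Propositional.Properties as Unique
open import Data.List.Relation.Unary.Unique.DecPropositional.Properties using (deduplicate-!)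
open import Data.List.Relation.Binary.Permutation.Propositional.Properties using (shift; ∈-resp-↭; ↭-length)
open import Data.Vec using (Vec; []; _∷_; replicate)
import Data.Vec as Vec
open import Data.Vec.Properties using (≡-dec; ∷-injective)
open import Data.Vec.Relation.Unary.All as VecAll using () renaming (All to AllVec)
import Data.Vec.Relation.Unary.All.Properties as VecAll
open import Data.Vec.Relation.Binary.Pointwise.Inductive using (Pointwise; []; _∷_)
open import Data.Vec.Relation.Binary.Pointwise.Extensional using (ext; Pointwise-≡⇒≡)

∣_-_∣₁ : ∀ {d} → Point d → Point d → ℕ
∣ [] - [] ∣₁ = 0
∣ x ∷ xs - y ∷ ys ∣₁ = ∣ x - y ∣ + ∣ xs - ys ∣₁

∣x-x∣₁≡0 : ∀ {d} (x : Point d) → ∣ x - x ∣₁ ≡ 0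
∣x-x∣₁≡0 [] = refl
∣x-x∣₁≡0 (x ∷ xs) rewrite ∣n-n∣≡0 x = ∣x-x∣₁≡0 xs

∣-∣₁-triangle : ∀ {d} (x y z : Point d) → ∣ x - z ∣₁ ≤ ∣ x - y ∣₁ + ∣ y - z ∣₁
∣-∣₁-triangle [] [] [] = z≤n
∣-∣₁-triangle (x ∷ xs) (y ∷ ys) (z ∷ zs) = begin
  ∣ x - z ∣ + ∣ xs - zs ∣₁
    ≤⟨ +-mono-≤ (∣-∣-triangle x y z) (∣-∣₁-triangle xs ys zs) ⟩
  (∣ x - y ∣ + ∣ y - z ∣) + (∣ xs - ys ∣₁ + ∣ ys - zs ∣₁)
    ≡⟨ interchange ∣ x - y ∣ ∣ y - z ∣ ∣ xs - ys ∣₁ ∣ ys - zs ∣₁ ⟩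
  (∣ x - y ∣ + ∣ xs - ys ∣₁) + (∣ y - z ∣ + ∣ ys - zs ∣₁) ∎
  where open ≤-Reasoning

InBox : ∀ {d} → Vec ℕ d → Point d → Set
InBox [] [] = ⊤
InBox (n ∷ ns) (x ∷ xs) = (1 ≤ x × x ≤ n) × InBox ns xs

InGrid⇒InBox : ∀ {d} (ns : Vec ℕ d) {x} → InGrid ns x → InBox ns x
InGrid⇒InBox [] {[]} _ = tt
InGrid⇒InBox (n ∷ ns) {x ∷ xs} g = g fz , InGrid⇒InBox ns (λ i → g (fs i))

InBox⇒InGrid : ∀ {d} (ns : Vec ℕ d) {x} → InBox ns x → InGrid ns x
InBox⇒InGrid (n ∷ ns) {x ∷ xs} (b , _) fz = b
InBox⇒InGrid (n ∷ ns) {x ∷ xs} (_ , g) (fs i) = InBox⇒InGrid ns g i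

GridAdj-here : ∀ {d} {a b} (xs : Point d) → ∣ a - b ∣ ≡ 1 → GridAdj (a ∷ xs) (b ∷ xs)
GridAdj-here xs e = fz , e , λ { fz fz≢fz → ⊥-elim (fz≢fz refl) ; (fs j) _ → refl }

GridAdj-there : ∀ {d} a {xs ys : Point d} → GridAdj xs ys → GridAdj (a ∷ xs) (a ∷ ys)
GridAdj-there a (i , e , h) = fs i , e , λ { fz _ → refl ; (fs j) j≢i → h j (λ j≡i → j≢i (cong fs j≡i)) }

GridAdj⇒∣-∣₁≤suc : ∀ {d} (x y z : Point d) → GridAdj x y → ∣ x - z ∣₁ ≤ suc ∣ y - z ∣₁
GridAdj⇒∣-∣₁≤suc (a ∷ xs) (b ∷ ys) (c ∷ zs) (fz , e , h)
  with refl ← Pointwise-≡⇒≡ {xs = xs} {ys} (ext λ j → h (fs j) λ ()) = +-monoˡ-≤ ∣ xs - zs ∣₁ (begin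
    ∣ a - c ∣             ≤⟨ ∣-∣-triangle a b c ⟩
    ∣ a - b ∣ + ∣ b - c ∣ ≡⟨ cong (_+ ∣ b - c ∣) e ⟩
    suc ∣ b - c ∣         ∎)
  where open ≤-Reasoning
GridAdj⇒∣-∣₁≤suc (a ∷ xs) (b ∷ ys) (c ∷ zs) (fs i , e , h) with refl ← h fz (λ ()) =
  subst (∣ a - c ∣ + ∣ xs - zs ∣₁ ≤_) (+-suc ∣ a - c ∣ ∣ ys - zs ∣₁)
    (+-monoʳ-≤ ∣ a - c ∣ (GridAdj⇒∣-∣₁≤suc xs ys zs (i , e , λ j j≢i → h (fs j) (λ { refl → j≢i refl }))))

Walk-map : ∀ {V W : Set} {R : V → V → Set} {S : W → W → Set} (f : V → W) →
  (∀ {x y} → R x y → S (f x) (f y)) → ∀ {x y k} → Walk R x y k → Walk S (f x) (f y) k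
Walk-map f h here = here
Walk-map f h (step r p) = step (h r) (Walk-map f h p)

module _ {V : Set} {R : V → V → Set} where

  _◅◅_ : ∀ {x y z k l} → Walk R x y k → Walk R y z l → Walk R x z (k + l)
  here ◅◅ q = q
  step r p ◅◅ q = step r (p ◅◅ q)

  Walk-⊓ : ∀ {x y m n} → Walk R x y m → Walk R x y n → Walk R x y (m ⊓ n)
  Walk-⊓ {m = m} {n} p q with ⊓-sel m n
  ... | inj₁ m⊓n≡m rewrite m⊓n≡m = p
  ... | inj₂ m⊓n≡n rewrite m⊓n≡n = q

Dist-unique : ∀ {V : Set} {R : V → V → Set} {x y k l} → Dist R x y k → Dist R x y l → k ≡ l
Dist-unique (p , p-min) (q , q-min) = ≤-antisym (p-min _ q) (q-min _ p)

GridEdge : ∀ {d} → Vec ℕ d → Point d → Point d → Set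
GridEdge ns x y = InBox ns x × InBox ns y × GridAdj x y

∣n-1+n∣≡1 : ∀ n → ∣ n - suc n ∣ ≡ 1
∣n-1+n∣≡1 zero = refl
∣n-1+n∣≡1 (suc n) = ∣n-1+n∣≡1 n

module _ {d} {n : ℕ} {ns : Vec ℕ d} {B : Point d} (B∈ : InBox ns B) where

  descend : ∀ k {a} → 1 ≤ a → k + a ≤ n → Walk (GridEdge (n ∷ ns)) (k + a ∷ B) (a ∷ B) k
  descend zero 1≤a k+a≤n = here
  descend (suc k) {a} 1≤a k+a<n =
    step (((s≤s z≤n , k+a<n) , B∈) , ((≤-trans 1≤a (m≤n+m a k) , k+a≤n) , B∈) ,
          GridAdj-here B (trans (∣-∣-comm (suc (k + a)) (k + a)) (∣n-1+n∣≡1 (k + a))))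
         (descend k 1≤a k+a≤n)
    where k+a≤n = <⇒≤ k+a<n

  ascend : ∀ k {a} → 1 ≤ a → k + a ≤ n → Walk (GridEdge (n ∷ ns)) (a ∷ B) (k + a ∷ B) k
  ascend zero 1≤a k+a≤n = here
  ascend (suc k) {a} 1≤a k+a<n =
    step (((1≤a , ≤-trans (m≤n+m a (suc k)) k+a<n) , B∈) ,
          ((s≤s z≤n , ≤-trans (m≤n+m (suc a) k) k+1+a≤n) , B∈) ,
          GridAdj-here B (∣n-1+n∣≡1 a))
         (subst (λ b → Walk (GridEdge (n ∷ ns)) (suc a ∷ B) (b ∷ B) k) (+-suc k a)
                (ascend k (s≤s z≤n) k+1+a≤n))
    where k+1+a≤n = subst (_≤ n) (sym (+-suc k a)) k+a<n

  line-walk : ∀ {a b} → 1 ≤ a → a ≤ n → 1 ≤ b → b ≤ n → Walk (GridEdge (n ∷ ns)) (a ∷ B) (b ∷ B) ∣ a - b ∣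
  line-walk {a} {b} 1≤a a≤n 1≤b b≤n with ≤-total a b
  ... | inj₁ a≤b = subst₂ (λ c l → Walk (GridEdge (n ∷ ns)) (a ∷ B) (c ∷ B) l)
                     (m∸n+n≡m a≤b) (sym (m≤n⇒∣m-n∣≡n∸m a≤b))
                     (ascend (b ∸ a) 1≤a (subst (_≤ n) (sym (m∸n+n≡m a≤b)) b≤n))
  ... | inj₂ b≤a = subst₂ (λ c l → Walk (GridEdge (n ∷ ns)) (c ∷ B) (b ∷ B) l)
                     (m∸n+n≡m b≤a) (sym (m≤n⇒∣n-m∣≡n∸m b≤a))
                     (descend (a ∸ b) 1≤b (subst (_≤ n) (sym (m∸n+n≡m b≤a)) a≤n))

lift-walk : ∀ {d n} {ns : Vec ℕ d} {a} → 1 ≤ a → a ≤ n → ∀ {xs ys k} →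
  Walk (GridEdge ns) xs ys k → Walk (GridEdge (n ∷ ns)) (a ∷ xs) (a ∷ ys) k
lift-walk {a = a} 1≤a a≤n =
  Walk-map (a ∷_) λ (xs∈ , ys∈ , adj) → ((1≤a , a≤n) , xs∈) , ((1≤a , a≤n) , ys∈) , GridAdj-there a adj

grid-walk : ∀ {d} (ns : Vec ℕ d) {A X} → InBox ns A → InBox ns X → Walk (GridEdge ns) A X ∣ A - X ∣₁
grid-walk [] {[]} {[]} _ _ = here
grid-walk (n ∷ ns) {a ∷ A} {x ∷ X} ((1≤a , a≤n) , A∈) ((1≤x , x≤n) , X∈) =
  line-walk A∈ 1≤a a≤n 1≤x x≤n ◅◅ lift-walk 1≤x x≤n (grid-walk ns A∈ X∈)

via : ∀ {d} → Point d → Point d → Point d → Point d → ℕ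
via E F A X = ∣ A - E ∣₁ + suc ∣ F - X ∣₁

dist′ : ∀ {d} → Point d → Point d → Point d → Point d → ℕ
dist′ E F A X = ∣ A - X ∣₁ ⊓ (via E F A X ⊓ via F E A X)

dist′-swap : ∀ {d} (E F A X : Point d) → dist′ F E A X ≡ dist′ E F A X
dist′-swap E F A X = cong (∣ A - X ∣₁ ⊓_) (⊓-comm (via F E A X) (via E F A X))

module _ {d} (E F : Point d) where

  dist′≤∣-∣₁ : ∀ A X → dist′ E F A X ≤ ∣ A - X ∣₁
  dist′≤∣-∣₁ A X = m⊓n≤m _ _

  dist′≤via : ∀ A X → dist′ E F A X ≤ via E F A X
  dist′≤via A X = ≤-trans (m⊓n≤n _ _) (m⊓n≤m _ _)

  dist′-glb : ∀ {k} A X → k ≤ ∣ A - X ∣₁ → k ≤ via E F A X → k ≤ via F E A X → k ≤ dist′ E F A X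
  dist′-glb A X p q r = ⊓-glb p (⊓-glb q r)

  dist′-gridStep : ∀ x y Z → GridAdj x y → dist′ E F x Z ≤ suc (dist′ E F y Z)
  dist′-gridStep x y Z adj = ⊓-mono-≤ (GridAdj⇒∣-∣₁≤suc x y Z adj)
    (⊓-mono-≤ (+-monoˡ-≤ (suc ∣ F - Z ∣₁) (GridAdj⇒∣-∣₁≤suc x y E adj))
              (+-monoˡ-≤ (suc ∣ E - Z ∣₁) (GridAdj⇒∣-∣₁≤suc x y F adj)))

  dist′-shortcutStep : ∀ Z → dist′ E F E Z ≤ suc (dist′ E F F Z)
  dist′-shortcutStep Z = ⊓-glb E→F→Z (⊓-glb
    (≤-trans E→F→Z (m≤n⇒m≤1+n (m≤n+m _ ∣ F - E ∣₁)))
    (≤-trans (dist′≤∣-∣₁ E Z) (m≤n⇒m≤1+n (≤-trans (n≤1+n _) (m≤n+m _ ∣ F - F ∣₁)))))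
    where
    E→F→Z : dist′ E F E Z ≤ suc ∣ F - Z ∣₁
    E→F→Z = subst (λ e → dist′ E F E Z ≤ e + suc ∣ F - Z ∣₁) (∣x-x∣₁≡0 E) (dist′≤via E Z)

dist′-step : ∀ {d} (ns : Vec ℕ d) {E F x y : Point d} Z →
  AdjG' ns E F x y → dist′ E F x Z ≤ suc (dist′ E F y Z)
dist′-step ns {E} {F} {x} {y} Z (_ , _ , inj₁ adj) = dist′-gridStep E F x y Z adj
dist′-step ns {E} {F} Z (_ , _ , inj₂ (inj₁ (refl , refl))) = dist′-shortcutStep E F Z
dist′-step ns {E} {F} Z (_ , _ , inj₂ (inj₂ (refl , refl))) =
  subst₂ (λ a b → a ≤ suc b) (dist′-swap E F F Z) (dist′-swap E F E Z) (dist′-shortcutStep F E Z)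

dist′≤length : ∀ {d} (ns : Vec ℕ d) {E F x Z : Point d} {m} → Walk (AdjG' ns E F) x Z m → dist′ E F x Z ≤ m
dist′≤length ns {E} {F} {x} here = ≤-trans (dist′≤∣-∣₁ E F x x) (≤-reflexive (∣x-x∣₁≡0 x))
dist′≤length ns {Z = Z} (step adj p) = ≤-trans (dist′-step ns Z adj) (s≤s (dist′≤length ns p))

module _ {d} (ns : Vec ℕ d) {E F : Point d} (E∈ : InBox ns E) (F∈ : InBox ns F) where

  private
    direct : ∀ {A X} → InBox ns A → InBox ns X → Walk (AdjG' ns E F) A X ∣ A - X ∣₁
    direct A∈ X∈ = Walk-map id
      (λ (x∈ , y∈ , adj) → InBox⇒InGrid ns x∈ , InBox⇒InGrid ns y∈ , inj₁ adj) (grid-walk ns A∈ X∈)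

    E—F : AdjG' ns E F E F
    E—F = InBox⇒InGrid ns E∈ , InBox⇒InGrid ns F∈ , inj₂ (inj₁ (refl , refl))

    F—E : AdjG' ns E F F E
    F—E = InBox⇒InGrid ns F∈ , InBox⇒InGrid ns E∈ , inj₂ (inj₂ (refl , refl))

  dist′-walk : ∀ {A X} → InBox ns A → InBox ns X → Walk (AdjG' ns E F) A X (dist′ E F A X)
  dist′-walk A∈ X∈ = Walk-⊓ (direct A∈ X∈)
    (Walk-⊓ (direct A∈ E∈ ◅◅ step E—F (direct F∈ X∈)) (direct A∈ F∈ ◅◅ step F—E (direct E∈ X∈)))

  Dist-dist′ : ∀ {A X} → InBox ns A → InBox ns X → Dist (AdjG' ns E F) A X (dist′ E F A X)
  Dist-dist′ A∈ X∈ = dist′-walk A∈ X∈ , λ _ → dist′≤length ns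

-- The corners (n₁,1,…,1), (1,n₂,1,…,1), …, (1,…,1,n_{d-1},1) and (1,…,1).
corners : ∀ {d} → Vec ℕ d → List (Point d)
corners [] = []
corners (n ∷ []) = (1 ∷ []) ∷ []
corners (n ∷ ns@(_ ∷ _)) = (n ∷ replicate _ 1) ∷ map (1 ∷_) (corners ns)

length-corners : ∀ {d} (ns : Vec ℕ d) → length (corners ns) ≡ d
length-corners [] = refl
length-corners (n ∷ []) = refl
length-corners (n ∷ ns@(_ ∷ _)) = cong suc (trans (length-map (1 ∷_) (corners ns)) (length-corners ns))

replicate-1∈corners : ∀ {d} n (ns : Vec ℕ d) → replicate _ 1 ∈ corners (n ∷ ns)
replicate-1∈corners n [] = here refl
replicate-1∈corners n (m ∷ ns) = there (∈-map⁺ (1 ∷_) (replicate-1∈corners m ns))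

IsCorner : ∀ {d} → Vec ℕ d → Point d → Set
IsCorner [] [] = ⊤
IsCorner (n ∷ ns) (x ∷ xs) = (x ≡ 1 ⊎ x ≡ n) × IsCorner ns xs

IsCorner-replicate-1 : ∀ {d} (ns : Vec ℕ d) → IsCorner ns (replicate _ 1)
IsCorner-replicate-1 [] = tt
IsCorner-replicate-1 (n ∷ ns) = inj₁ refl , IsCorner-replicate-1 ns

corners-IsCorner : ∀ {d} (ns : Vec ℕ d) {c} → c ∈ corners ns → IsCorner ns c
corners-IsCorner (n ∷ []) (here refl) = inj₁ refl , tt
corners-IsCorner (n ∷ ns@(_ ∷ _)) (here refl) = inj₂ refl , IsCorner-replicate-1 ns
corners-IsCorner (n ∷ ns@(_ ∷ _)) (there c∈) with c′ , c′∈ , refl ← ∈-map⁻ (1 ∷_) c∈ =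
  inj₁ refl , corners-IsCorner ns c′∈

antipode : ∀ {d} → Vec ℕ d → Point d → Point d
antipode [] [] = []
antipode (n ∷ ns) (x ∷ xs) = (suc n ∸ x) ∷ antipode ns xs

diameter : ∀ {d} → Vec ℕ d → ℕ
diameter [] = 0
diameter (n ∷ ns) = (n ∸ 1) + diameter ns

IsCorner⇒InBox : ∀ {d} (ns : Vec ℕ d) {A c} → InBox ns A → IsCorner ns c → InBox ns c
IsCorner⇒InBox [] {[]} {[]} _ _ = tt
IsCorner⇒InBox (n ∷ ns) {a ∷ A} {.1 ∷ c} ((1≤a , a≤n) , A∈) (inj₁ refl , c-corner) =
  (≤-refl , ≤-trans 1≤a a≤n) , IsCorner⇒InBox ns A∈ c-corner
IsCorner⇒InBox (n ∷ ns) {a ∷ A} {.n ∷ c} ((1≤a , a≤n) , A∈) (inj₂ refl , c-corner) =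
  (≤-trans 1≤a a≤n , ≤-refl) , IsCorner⇒InBox ns A∈ c-corner

IsCorner-antipode : ∀ {d} (ns : Vec ℕ d) {c} → IsCorner ns c → IsCorner ns (antipode ns c)
IsCorner-antipode [] {[]} _ = tt
IsCorner-antipode (n ∷ ns) {.1 ∷ c} (inj₁ refl , c-corner) = inj₂ refl , IsCorner-antipode ns c-corner
IsCorner-antipode (n ∷ ns) {.n ∷ c} (inj₂ refl , c-corner) =
  inj₁ (m+n∸n≡m 1 n) , IsCorner-antipode ns c-corner

∣x-1∣+∣x-n∣≡n∸1 : ∀ {x n} → 1 ≤ x → x ≤ n → ∣ x - 1 ∣ + ∣ x - n ∣ ≡ n ∸ 1
∣x-1∣+∣x-n∣≡n∸1 {suc x} {suc n} (s≤s z≤n) (s≤s x≤n) =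
  trans (cong₂ _+_ (∣-∣-identityʳ x) (m≤n⇒∣m-n∣≡n∸m x≤n)) (m+[n∸m]≡n x≤n)

∣-∣₁-antipode : ∀ {d} (ns : Vec ℕ d) {X c} → InBox ns X → IsCorner ns c →
  ∣ X - c ∣₁ + ∣ X - antipode ns c ∣₁ ≡ diameter ns
∣-∣₁-antipode [] {[]} {[]} _ _ = refl
∣-∣₁-antipode (n ∷ ns) {x ∷ X} {c ∷ cs} ((1≤x , x≤n) , X∈) (c-end , cs-corner) = begin
  (∣ x - c ∣ + ∣ X - cs ∣₁) + (∣ x - (suc n ∸ c) ∣ + ∣ X - antipode ns cs ∣₁)
    ≡⟨ interchange ∣ x - c ∣ ∣ X - cs ∣₁ ∣ x - (suc n ∸ c) ∣ ∣ X - antipode ns cs ∣₁ ⟩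
  (∣ x - c ∣ + ∣ x - (suc n ∸ c) ∣) + (∣ X - cs ∣₁ + ∣ X - antipode ns cs ∣₁)
    ≡⟨ cong₂ _+_ (both-ends c-end) (∣-∣₁-antipode ns X∈ cs-corner) ⟩
  (n ∸ 1) + diameter ns ∎
  where
  open ≡-Reasoning
  both-ends : c ≡ 1 ⊎ c ≡ n → ∣ x - c ∣ + ∣ x - (suc n ∸ c) ∣ ≡ n ∸ 1
  both-ends (inj₁ refl) = ∣x-1∣+∣x-n∣≡n∸1 1≤x x≤n
  both-ends (inj₂ refl) rewrite m+n∸n≡m 1 n = trans (+-comm ∣ x - n ∣ ∣ x - 1 ∣) (∣x-1∣+∣x-n∣≡n∸1 1≤x x≤n)

+-compensate : ∀ {p q u v} → p < q → p + u ≡ q + v → v < u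
+-compensate {u = u} {v} p<q e with u ≤? v
... | yes u≤v = ⊥-elim (<⇒≢ (+-mono-<-≤ p<q u≤v) e)
... | no u≰v = ≰⇒> u≰v

∣-1∣-mono-< : ∀ {a b} → 1 ≤ a → a < b → ∣ a - 1 ∣ < ∣ b - 1 ∣
∣-1∣-mono-< {suc a} {suc b} (s≤s z≤n) (s≤s a<b) rewrite ∣-∣-identityʳ a | ∣-∣-identityʳ b = a<b

∣-1∣-injective : ∀ {a b} → 1 ≤ a → 1 ≤ b → ∣ a - 1 ∣ ≡ ∣ b - 1 ∣ → a ≡ b
∣-1∣-injective {suc a} {suc b} (s≤s z≤n) (s≤s z≤n) e =
  cong suc (trans (sym (∣-∣-identityʳ a)) (trans e (∣-∣-identityʳ b)))

∣-n∣-mono-> : ∀ {a b n} → a < b → b ≤ n → ∣ b - n ∣ < ∣ a - n ∣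
∣-n∣-mono-> a<b b≤n rewrite m≤n⇒∣m-n∣≡n∸m b≤n | m≤n⇒∣m-n∣≡n∸m (≤-trans (<⇒≤ a<b) b≤n) = ∸-monoʳ-< a<b b≤n

coordinate-from-ends : ∀ {n a b u v} → 1 ≤ a → a ≤ n → 1 ≤ b → b ≤ n →
  ∣ a - 1 ∣ + u ≡ ∣ b - 1 ∣ + v → ∣ a - n ∣ + u ≡ ∣ b - n ∣ + v → a ≡ b
coordinate-from-ends {n} {a} {b} 1≤a a≤n 1≤b b≤n e₁ e₂ with <-cmp a b
... | tri< a<b _ _ = ⊥-elim (<-asym (+-compensate (∣-1∣-mono-< 1≤a a<b) e₁)
                                    (+-compensate (∣-n∣-mono-> a<b b≤n) (sym e₂)))
... | tri≈ _ a≡b _ = a≡b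
... | tri> _ _ b<a = ⊥-elim (<-asym (+-compensate (∣-1∣-mono-< 1≤b b<a) (sym e₁))
                                    (+-compensate (∣-n∣-mono-> b<a a≤n) e₂))

corners-resolve : ∀ {d} (ns : Vec ℕ d) {A B} → InBox ns A → InBox ns B →
  (∀ {c} → c ∈ corners ns → ∣ A - c ∣₁ ≡ ∣ B - c ∣₁) → A ≡ B
corners-resolve [] {[]} {[]} _ _ _ = refl
corners-resolve (n ∷ []) {a ∷ []} {b ∷ []} ((1≤a , _) , _) ((1≤b , _) , _) same =
  cong (_∷ []) (∣-1∣-injective 1≤a 1≤b (+-cancelʳ-≡ 0 _ _ (same (here refl))))
corners-resolve (n ∷ ns@(_ ∷ _)) {a ∷ A} {b ∷ B} ((1≤a , a≤n) , A∈) ((1≤b , b≤n) , B∈) same =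
  cong₂ _∷_ a≡b (corners-resolve ns A∈ B∈ λ c∈ → +-cancelˡ-≡ ∣ b - 1 ∣ _ _
    (subst (λ x → ∣ x - 1 ∣ + ∣ A - _ ∣₁ ≡ ∣ b - 1 ∣ + ∣ B - _ ∣₁) a≡b (same (there (∈-map⁺ (1 ∷_) c∈)))))
  where
  a≡b : a ≡ b
  a≡b = coordinate-from-ends 1≤a a≤n 1≤b b≤n
    (same (there (∈-map⁺ (1 ∷_) (replicate-1∈corners _ _)))) (same (here refl))

module _ {d} (E F : Point d) where

  dist′≡∣-∣₁ : ∀ {A X} → ∣ A - E ∣₁ ≤ ∣ A - F ∣₁ → ∣ E - X ∣₁ ≤ ∣ F - X ∣₁ → dist′ E F A X ≡ ∣ A - X ∣₁
  dist′≡∣-∣₁ {A} {X} A-E≤A-F E-X≤F-X = ≤-antisym (dist′≤∣-∣₁ E F A X) (dist′-glb E F A X ≤-refl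
    (≤-trans (∣-∣₁-triangle A E X) (+-monoʳ-≤ ∣ A - E ∣₁ (m≤n⇒m≤1+n E-X≤F-X)))
    (≤-trans (∣-∣₁-triangle A E X) (+-mono-≤ A-E≤A-F (n≤1+n _))))

  closer-to-E⇒dist′≤ : ∀ {A} → ∣ A - E ∣₁ ≤ ∣ A - F ∣₁ → dist′ E F A E ≤ dist′ E F A F
  closer-to-E⇒dist′≤ {A} A-E≤A-F = ≤-trans (dist′≤∣-∣₁ E F A E)
    (dist′-glb E F A F A-E≤A-F (m≤m+n _ _) (≤-trans A-E≤A-F (m≤m+n _ _)))

  dist′≤⇒closer-to-E : ∀ {A} → dist′ E F A E ≤ dist′ E F A F → ∣ A - E ∣₁ ≤ ∣ A - F ∣₁
  dist′≤⇒closer-to-E {A} dist′≤ with ∣ A - E ∣₁ ≤? ∣ A - F ∣₁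
  ... | yes A-E≤A-F = A-E≤A-F
  ... | no A-E≰A-F = ⊥-elim (<⇒≱ (≤-trans (s≤s (dist′≤∣-∣₁ E F A F)) (dist′-glb E F A E F-closer
      (≤-trans F-closer (m≤m+n _ _))
      (≤-trans (s≤s (m≤m+n _ _)) (≤-reflexive (sym (+-suc _ _)))))) dist′≤)
    where F-closer = ≰⇒> A-E≰A-F

  closer-to-E-transfer : ∀ {A B} → dist′ E F A E ≡ dist′ E F B E → dist′ E F A F ≡ dist′ E F B F →
    ∣ A - E ∣₁ ≤ ∣ A - F ∣₁ → ∣ B - E ∣₁ ≤ ∣ B - F ∣₁
  closer-to-E-transfer {A} {B} same-E same-F A-E≤A-F =
    dist′≤⇒closer-to-E {B} (subst₂ _≤_ same-E same-F (closer-to-E⇒dist′≤ {A} A-E≤A-F))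

cornersWithAntipodes : ∀ {d} → Vec ℕ d → List (Point d)
cornersWithAntipodes ns = corners ns ++ map (antipode ns) (corners ns)

landmarks : ∀ {d} → Vec ℕ d → Point d → Point d → List (Point d)
landmarks ns E F = E ∷ F ∷ cornersWithAntipodes ns

Separates : ∀ {d} → Vec ℕ d → Point d → Point d → List (Point d) → Set
Separates ns E F R = ∀ {A B} → InBox ns A → InBox ns B →
  (∀ {X} → X ∈ R → dist′ E F A X ≡ dist′ E F B X) → A ≡ B

module _ {d} (ns : Vec ℕ d) {E F : Point d} (E∈ : InBox ns E) (F∈ : InBox ns F) where

  closer-to-E-separated : ∀ {A B} → InBox ns A → InBox ns B →
    ∣ A - E ∣₁ ≤ ∣ A - F ∣₁ → ∣ B - E ∣₁ ≤ ∣ B - F ∣₁ →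
    (∀ {X} → X ∈ cornersWithAntipodes ns → dist′ E F A X ≡ dist′ E F B X) → A ≡ B
  closer-to-E-separated {A} {B} A∈ B∈ A-E≤A-F B-E≤B-F same = corners-resolve ns A∈ B∈ same-corner
    where
    same-ℓ₁ : ∀ {X} → X ∈ cornersWithAntipodes ns → ∣ E - X ∣₁ ≤ ∣ F - X ∣₁ → ∣ A - X ∣₁ ≡ ∣ B - X ∣₁
    same-ℓ₁ {X} X∈ E-X≤F-X = begin
      ∣ A - X ∣₁      ≡⟨ dist′≡∣-∣₁ E F {A} A-E≤A-F E-X≤F-X ⟨
      dist′ E F A X  ≡⟨ same X∈ ⟩
      dist′ E F B X  ≡⟨ dist′≡∣-∣₁ E F {B} B-E≤B-F E-X≤F-X ⟩
      ∣ B - X ∣₁      ∎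
      where open ≡-Reasoning
    same-corner : ∀ {c} → c ∈ corners ns → ∣ A - c ∣₁ ≡ ∣ B - c ∣₁
    same-corner {c} c∈ with ∣ E - c ∣₁ ≤? ∣ F - c ∣₁
    ... | yes E-c≤F-c = same-ℓ₁ (∈-++⁺ˡ c∈) E-c≤F-c
    ... | no E-c≰F-c = +-cancelʳ-≡ _ _ _ (begin
      ∣ A - c ∣₁ + ∣ A - c̄ ∣₁  ≡⟨ ∣-∣₁-antipode ns A∈ c-corner ⟩
      diameter ns            ≡⟨ ∣-∣₁-antipode ns B∈ c-corner ⟨
      ∣ B - c ∣₁ + ∣ B - c̄ ∣₁  ≡⟨ cong (∣ B - c ∣₁ +_) (same-ℓ₁ (∈-++⁺ʳ (corners ns) c̄∈) E-c̄≤F-c̄) ⟨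
      ∣ B - c ∣₁ + ∣ A - c̄ ∣₁  ∎)
      where
      open ≡-Reasoning
      c̄ = antipode ns c
      c̄∈ = ∈-map⁺ (antipode ns) c∈
      c-corner = corners-IsCorner ns c∈
      E-c̄≤F-c̄ : ∣ E - c̄ ∣₁ ≤ ∣ F - c̄ ∣₁
      E-c̄≤F-c̄ = <⇒≤ (+-compensate (≰⇒> E-c≰F-c)
        (trans (∣-∣₁-antipode ns F∈ c-corner) (sym (∣-∣₁-antipode ns E∈ c-corner))))

landmarks-separate : ∀ {d} (ns : Vec ℕ d) {E F} → InBox ns E → InBox ns F →
  Separates ns E F (landmarks ns E F)
landmarks-separate ns {E} {F} E∈ F∈ {A} {B} A∈ B∈ same with ∣ A - E ∣₁ ≤? ∣ A - F ∣₁
... | yes A-E≤A-F = closer-to-E-separated ns E∈ F∈ A∈ B∈ A-E≤A-F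
  (closer-to-E-transfer E F {A} {B} (same (here refl)) (same (there (here refl))) A-E≤A-F)
  (λ X∈ → same (there (there X∈)))
... | no A-E≰A-F = closer-to-E-separated ns F∈ E∈ A∈ B∈ A-F≤A-E
  (closer-to-E-transfer F E {A} {B} (swapped (same (there (here refl)))) (swapped (same (here refl)))
    A-F≤A-E)
  (λ X∈ → swapped (same (there (there X∈))))
  where
  A-F≤A-E = <⇒≤ (≰⇒> A-E≰A-F)
  swapped : ∀ {X} → dist′ E F A X ≡ dist′ E F B X → dist′ F E A X ≡ dist′ F E B X
  swapped {X} e = trans (dist′-swap E F A X) (trans e (sym (dist′-swap E F B X)))

_≟ₚ_ : ∀ {d} → DecidableEquality (Point d)
_≟ₚ_ = ≡-dec _≟_

module _ {d} (ns : Vec ℕ d) {E F : Point d} (E∈ : InBox ns E) (F∈ : InBox ns F) where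

  Separates⇒Resolving : ∀ {R} → All (InBox ns) R → Separates ns E F R → Resolving ns E F R
  Separates⇒Resolving {R} R∈ separates = All.map (InBox⇒InGrid ns) R∈ , resolve
    where
    resolve : ∀ A B → InGrid ns A → InGrid ns B → A ≢ B → ∃[ X ] (X ∈ R × ∃[ k₁ ] ∃[ k₂ ]
      (Dist (AdjG' ns E F) A X k₁ × Dist (AdjG' ns E F) B X k₂ × k₁ ≢ k₂))
    resolve A B A∈ B∈ A≢B with all? (λ X → dist′ E F A X ≟ dist′ E F B X) R
    ... | yes same = ⊥-elim (A≢B (separates (InGrid⇒InBox ns A∈) (InGrid⇒InBox ns B∈) (All.lookup same)))
    ... | no ¬same with X , X∈R , differ ← find (¬All⇒Any¬ (λ X → dist′ E F A X ≟ dist′ E F B X) R ¬same) =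
      X , X∈R , _ , _ , Dist-dist′ ns E∈ F∈ (InGrid⇒InBox ns A∈) X∈ ,
      Dist-dist′ ns E∈ F∈ (InGrid⇒InBox ns B∈) X∈ , differ
      where X∈ = All.lookup R∈ X∈R

  Resolving⇒Separates : ∀ {R} → Resolving ns E F R → Separates ns E F R
  Resolving⇒Separates (R∈ , resolve) {A} {B} A∈ B∈ same with A ≟ₚ B
  ... | yes A≡B = A≡B
  ... | no A≢B
    with X , X∈R , k₁ , k₂ , A-X , B-X , k₁≢k₂ ← resolve A B (InBox⇒InGrid ns A∈) (InBox⇒InGrid ns B∈) A≢B =
    ⊥-elim (k₁≢k₂ (begin
      k₁             ≡⟨ Dist-unique A-X (Dist-dist′ ns E∈ F∈ A∈ X∈) ⟩
      dist′ E F A X  ≡⟨ same X∈R ⟩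
      dist′ E F B X  ≡⟨ Dist-unique B-X (Dist-dist′ ns E∈ F∈ B∈ X∈) ⟨
      k₂             ∎))
    where
    open ≡-Reasoning
    X∈ = InGrid⇒InBox ns (All.lookup R∈ X∈R)

  landmarks-InBox : All (InBox ns) (landmarks ns E F)
  landmarks-InBox = E∈ ∷ F∈ ∷ All.++⁺ (All.tabulate (λ {c} c∈ → corner∈ (corners-IsCorner ns c∈)))
    (All.map⁺ (All.tabulate (λ {c} c∈ → corner∈ (IsCorner-antipode ns (corners-IsCorner ns c∈)))))
    where
    corner∈ : ∀ {c} → IsCorner ns c → InBox ns c
    corner∈ = IsCorner⇒InBox ns E∈

  length-landmarks : length (landmarks ns E F) ≡ 2 * d + 2
  length-landmarks = begin
    2 + length (corners ns ++ map (antipode ns) (corners ns))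
      ≡⟨ cong (2 +_) (length-++ (corners ns)) ⟩
    2 + (length (corners ns) + length (map (antipode ns) (corners ns)))
      ≡⟨ cong₂ (λ a b → 2 + (a + b)) (length-corners ns) (trans (length-map _ (corners ns)) (length-corners ns)) ⟩
    2 + (d + d)
      ≡⟨ +-comm 2 (d + d) ⟩
    (d + d) + 2
      ≡⟨ cong (λ m → (d + m) + 2) (+-identityʳ d) ⟨
    2 * d + 2 ∎
    where open ≡-Reasoning

  metricDim≤2d+2 : ∀ {β} → IsMetricDim ns E F β → β ≤ 2 * d + 2
  metricDim≤2d+2 {β} (_ , minimal) = begin
    β                          ≤⟨ minimal R (Separates⇒Resolving R∈ R-separates) (deduplicate-! _≟ₚ_ L) ⟩
    length R                   ≤⟨ length-deduplicate _≟ₚ_ L ⟩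
    length L                   ≡⟨ length-landmarks ⟩
    2 * d + 2                  ∎
    where
    open ≤-Reasoning
    L = landmarks ns E F
    R = deduplicate _≟ₚ_ L
    R∈ = All.deduplicate⁺ _≟ₚ_ landmarks-InBox
    R-separates : Separates ns E F R
    R-separates A∈ B∈ same = landmarks-separate ns E∈ F∈ A∈ B∈ (λ X∈ → same (∈-deduplicate⁺ _≟ₚ_ X∈))

injection⇒length≤ : ∀ {A B : Set} (f : A → B) {xs ys} → Unique xs →
  (∀ {x y} → x ∈ xs → y ∈ xs → f x ≡ f y → x ≡ y) → (∀ {x} → x ∈ xs → f x ∈ ys) → length xs ≤ length ys
injection⇒length≤ f {[]} _ _ _ = z≤n
injection⇒length≤ f {x ∷ xs} (x∉xs ∷ xs!) injective into
  with h , t , refl ← ∈-∃++ (into (here refl)) = begin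
    suc (length xs)       ≤⟨ s≤s (injection⇒length≤ f xs! (λ p q → injective (there p) (there q)) into-tail) ⟩
    suc (length (h ++ t)) ≡⟨ ↭-length (shift (f x) h t) ⟨
    length (h ++ f x ∷ t) ∎
  where
  open ≤-Reasoning
  into-tail : ∀ {y} → y ∈ xs → f y ∈ h ++ t
  into-tail y∈ with ∈-resp-↭ (shift (f x) h t) (into (there y∈))
  ... | here fy≡fx = ⊥-elim (All.lookup x∉xs y∈ (injective (here refl) (there y∈) (sym fy≡fx)))
  ... | there fy∈ = fy∈

boxes : ∀ {A : Set} {d} → Vec (List A) d → List (Vec A d)
boxes [] = [] ∷ []
boxes (xs ∷ xss) = cartesianProductWith _∷_ xs (boxes xss)

length-cartesianProductWith : ∀ {A B C : Set} (f : A → B → C) xs ys →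
  length (cartesianProductWith f xs ys) ≡ length xs * length ys
length-cartesianProductWith f [] ys = refl
length-cartesianProductWith f (x ∷ xs) ys = begin
  length (map (f x) ys ++ cartesianProductWith f xs ys)  ≡⟨ length-++ (map (f x) ys) ⟩
  length (map (f x) ys) + length (cartesianProductWith f xs ys)
    ≡⟨ cong₂ _+_ (length-map (f x) ys) (length-cartesianProductWith f xs ys) ⟩
  length ys + length xs * length ys                      ∎
  where open ≡-Reasoning

length-boxes : ∀ {A : Set} {d} (xss : Vec (List A) d) → length (boxes xss) ≡ NΠ (Vec.map length xss)
length-boxes [] = refl
length-boxes (xs ∷ xss) =
  trans (length-cartesianProductWith _∷_ xs (boxes xss)) (cong (length xs *_) (length-boxes xss))

∈-boxes⁺ : ∀ {A : Set} {d} {v : Vec A d} {xss} → Pointwise _∈_ v xss → v ∈ boxes xss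
∈-boxes⁺ [] = here refl
∈-boxes⁺ (x∈ ∷ v∈) = Any.cartesianProductWith⁺ _∷_ (cong₂ _∷_) x∈ (∈-boxes⁺ v∈)

∈-boxes⁻ : ∀ {A : Set} {d} {v : Vec A d} xss → v ∈ boxes xss → Pointwise _∈_ v xss
∈-boxes⁻ {v = []} [] _ = []
∈-boxes⁻ {v = x ∷ v} (xs ∷ xss) v∈
  with x∈ , v∈′ ← Any.cartesianProductWith⁻ _∷_ ∷-injective xs (boxes xss) v∈ =
  x∈ ∷ ∈-boxes⁻ xss v∈′

boxes-Unique : ∀ {A : Set} {d} {xss : Vec (List A) d} → AllVec Unique xss → Unique (boxes xss)
boxes-Unique VecAll.[] = [] ∷ []
boxes-Unique (xs! VecAll.∷ xss!) = Unique.cartesianProductWith⁺ _∷_ ∷-injective xs! (boxes-Unique xss!)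

length-boxes-replicate : ∀ {A : Set} m (xs : List A) → length (boxes (replicate m xs)) ≡ length xs ^ m
length-boxes-replicate m xs = trans (length-boxes (replicate m xs)) (NΠ-lengths m)
  where
  NΠ-lengths : ∀ m → NΠ (Vec.map length (replicate m xs)) ≡ length xs ^ m
  NΠ-lengths zero = refl
  NΠ-lengths (suc m) = cong (length xs *_) (NΠ-lengths m)

range : ℕ → List ℕ
range n = applyUpTo suc n

∈-range⁻ : ∀ {n x} → x ∈ range n → 1 ≤ x × x ≤ n
∈-range⁻ x∈ with i , i<n , refl ← ∈-applyUpTo⁻ suc x∈ = s≤s z≤n , i<n

gridPoints : ∀ {d} → Vec ℕ d → List (Point d)
gridPoints ns = boxes (Vec.map range ns)

gridPoints-InBox : ∀ {d} (ns : Vec ℕ d) {x} → x ∈ gridPoints ns → InBox ns x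
gridPoints-InBox ns x∈ = InBox-ranges ns (∈-boxes⁻ (Vec.map range ns) x∈)
  where
  InBox-ranges : ∀ {d} (ns : Vec ℕ d) {x} → Pointwise _∈_ x (Vec.map range ns) → InBox ns x
  InBox-ranges [] [] = tt
  InBox-ranges (n ∷ ns) (x∈ ∷ xs∈) = ∈-range⁻ x∈ , InBox-ranges ns xs∈

gridPoints-Unique : ∀ {d} (ns : Vec ℕ d) → Unique (gridPoints ns)
gridPoints-Unique ns = boxes-Unique (VecAll.map⁺ (VecAll.universal range-Unique ns))
  where
  range-Unique : ∀ n → Unique (range n)
  range-Unique n = Unique.applyUpTo⁺₁ suc n (λ i<j _ → <⇒≢ (s≤s i<j))

length-gridPoints : ∀ {d} (ns : Vec ℕ d) → length (gridPoints ns) ≡ NΠ ns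
length-gridPoints ns = trans (length-boxes (Vec.map range ns)) (NΠ-lengths ns)
  where
  NΠ-lengths : ∀ {d} (ns : Vec ℕ d) → NΠ (Vec.map length (Vec.map range ns)) ≡ NΠ ns
  NΠ-lengths [] = refl
  NΠ-lengths (n ∷ ns) = cong₂ _*_ (length-applyUpTo suc n) (NΠ-lengths ns)

∣a-b∣<n : ∀ {n a b} → 1 ≤ a → a ≤ n → 1 ≤ b → b ≤ n → ∣ a - b ∣ < n
∣a-b∣<n {a = suc a} {suc b} (s≤s z≤n) a≤n (s≤s z≤n) b≤n = ≤-trans (s≤s (∣m-n∣≤m⊔n a b)) (⊔-lub a≤n b≤n)

∣-∣₁+d≤NΣ : ∀ {d} (ns : Vec ℕ d) {A X} → InBox ns A → InBox ns X → ∣ A - X ∣₁ + d ≤ NΣ ns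
∣-∣₁+d≤NΣ [] {[]} {[]} _ _ = z≤n
∣-∣₁+d≤NΣ {suc d} (n ∷ ns) {a ∷ A} {x ∷ X} ((1≤a , a≤n) , A∈) ((1≤x , x≤n) , X∈) = begin
  ∣ a - x ∣ + ∣ A - X ∣₁ + suc d    ≡⟨ +-suc _ d ⟩
  suc (∣ a - x ∣ + ∣ A - X ∣₁ + d)  ≡⟨ cong suc (+-assoc ∣ a - x ∣ _ d) ⟩
  suc ∣ a - x ∣ + (∣ A - X ∣₁ + d)  ≤⟨ +-mono-≤ (∣a-b∣<n 1≤a a≤n 1≤x x≤n) (∣-∣₁+d≤NΣ ns A∈ X∈) ⟩
  n + NΣ ns                         ∎
  where open ≤-Reasoning

dist′≤NΣ∸d : ∀ {d} (ns : Vec ℕ d) (E F : Point d) {A X} → InBox ns A → InBox ns X →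
  dist′ E F A X ≤ NΣ ns ∸ d
dist′≤NΣ∸d ns E F {A} {X} A∈ X∈ =
  ≤-trans (dist′≤∣-∣₁ E F A X) (m+n≤o⇒m≤o∸n ∣ A - X ∣₁ (∣-∣₁+d≤NΣ ns A∈ X∈))

map-fromList-≡⇒≗ : ∀ {A B : Set} {f g : A → B} xs →
  Vec.map f (Vec.fromList xs) ≡ Vec.map g (Vec.fromList xs) → ∀ {x} → x ∈ xs → f x ≡ g x
map-fromList-≡⇒≗ (y ∷ ys) e (here refl) = proj₁ (∷-injective e)
map-fromList-≡⇒≗ (y ∷ ys) e (there x∈) = map-fromList-≡⇒≗ ys (proj₂ (∷-injective e)) x∈

map-fromList∈replicate : ∀ {A B : Set} {f : A → B} {L} xs → (∀ {x} → x ∈ xs → f x ∈ L) →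
  Pointwise _∈_ (Vec.map f (Vec.fromList xs)) (replicate (length xs) L)
map-fromList∈replicate [] f∈ = []
map-fromList∈replicate (x ∷ xs) f∈ = f∈ (here refl) ∷ map-fromList∈replicate xs (λ x∈ → f∈ (there x∈))

module _ {d} (ns : Vec ℕ d) {E F : Point d} (E∈ : InBox ns E) (F∈ : InBox ns F) where

  Resolving⇒NΠ≤ : ∀ {R} → Resolving ns E F R → NΠ ns ≤ (NΣ ns ∸ d + 1) ^ length R
  Resolving⇒NΠ≤ {R} resolving@(R∈ , _) = begin
    NΠ ns                               ≡⟨ length-gridPoints ns ⟨
    length (gridPoints ns)
      ≤⟨ injection⇒length≤ signature (gridPoints-Unique ns) injective into ⟩
    length (boxes (replicate (length R) (upTo (suc D))))
                                        ≡⟨ length-boxes-replicate (length R) (upTo (suc D)) ⟩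
    length (upTo (suc D)) ^ length R    ≡⟨ cong (_^ length R) (trans (length-upTo (suc D)) (+-comm 1 D)) ⟩
    (D + 1) ^ length R                  ∎
    where
    open ≤-Reasoning
    D = NΣ ns ∸ d
    signature : Point d → Vec ℕ (length R)
    signature A = Vec.map (dist′ E F A) (Vec.fromList R)
    injective : ∀ {A B} → A ∈ gridPoints ns → B ∈ gridPoints ns → signature A ≡ signature B → A ≡ B
    injective A∈ B∈ e = Resolving⇒Separates ns E∈ F∈ resolving
      (gridPoints-InBox ns A∈) (gridPoints-InBox ns B∈) (map-fromList-≡⇒≗ R e)
    into : ∀ {A} → A ∈ gridPoints ns → signature A ∈ boxes (replicate (length R) (upTo (suc D)))
    into A∈ = ∈-boxes⁺ (map-fromList∈replicate R λ X∈R →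
      ∈-upTo⁺ (s≤s (dist′≤NΣ∸d ns E F (gridPoints-InBox ns A∈) (InGrid⇒InBox ns (All.lookup R∈ X∈R)))))

-- The distance formula behind dist′ holds for any E and F.
theorem1 : (d : ℕ) (n : Vec ℕ d) (E F : Point d) →
    InGrid n E → InGrid n F → E ≢ F → ¬ GridAdj E F →
    (β : ℕ) → IsMetricDim n E F β →
    (β ≤ 2 * d + 2) × (NΠ n ≤ (NΣ n ∸ d + 1) ^ β)
theorem1 d n E F E∈ F∈ _ _ β dim@((R , resolving , _ , |R|≡β) , _) =
  metricDim≤2d+2 n E∈′ F∈′ dim ,
  subst (λ m → NΠ n ≤ (NΣ n ∸ d + 1) ^ m) |R|≡β (Resolving⇒NΠ≤ n E∈′ F∈′ resolving)
  where
  E∈′ = InGrid⇒InBox n E∈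
  F∈′ = InGrid⇒InBox n F∈
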